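{- Fix an integer $N\geq2$. For every $h\in\mathbb{N}$ and every increasing function $\psi:\mathbb{N}\to\mathbb{N}$ with $\psi(n)>n^2$ for all $n\in\mathbb{N}$, the set \[ A_{h,\psi}:=\left\{x\in\mathbb{I}\;:\;(\mathbf{\Pi}(x,n))_{n}\text{ has property }P_{h,\psi}\right\} \] is residual (in $\mathbb{I}$).
   Context: $\mathbb{I}:=[0,1]\setminus\{x\in[0,1]: x\text{ has a terminating base- }N\text{ expansion}\}$. Each $x\in\mathbb{I}$ has base-$N$ expansion $x=\sum_{k\geq1}d_k(x)N^{ -k}$, $d_k(x)\in\{0,\dots,N-1\}$; $\Pi_i(x,n):=\frac1n|\{1\leq j\leq n:d_j(x)=i\}|$ and $\mathbf{\Pi}(x,n):=(\Pi_0(x,n),\dots,\Pi_{N-1}(x,n))$. $\Delta_N$ is the set of probability vectors in $\mathbb{R}^N$ and $\mathbb{D}:=(\mathbb{Q}^N\cap\Delta_N)\setminus\{(1,0,\dots,0),(0,\dots,0,1)\}$. $\psi^m$ denotes the $m$-fold composition of $\psi$. A sequence $(\mathbf{x}_n)_n$ in $\mathbb{R}^N$ has property $P_{h,\psi}$ if for all $i\in\mathbb{N}$, $m\in\mathbb{N}$ and $\mathbf{q}\in\mathbb{D}$ there exists $j\in\mathbb{N}$ with $j\geq i$, $\frac{j}{\psi(j)}\leq\frac1h$, and $\|\mathbf{x}_n-\mathbf{q}\|_1<\frac1h$ for all $n$ with $j\leq n\leq\psi^m(j)$. -}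

module Defs where

open import Data.Nat as ℕ using (ℕ; zero; suc; _≤_; _<_; _*_)
open import Data.Integer using (+_)
open import Data.Rational as ℚ using (ℚ; 0ℚ; 1ℚ; _/_; ∣_∣; _-_; _+_)
open import Data.Fin using (Fin; fromℕ) renaming (zero to fzero)
open import Data.Fin.Properties using (_≟_)
open import Data.List using (List; []; _∷_)
open import Data.Product using (Σ; ∃; _×_; _,_)
open import Relation.Nullary using (¬_; yes; no)
open import Relation.Binary.PropositionalEquality using (_≡_; _≢_)

-- Digit sequences: x k is the (k+1)-th base-N digit d_{k+1}(x).
Seq : ℕ → Set
Seq N = ℕ → Fin N

-- Points of 𝕀 (N = 2 + M): the digit sequence is not eventually 0
-- (no terminating expansion) and not eventually N-1 (no terminating
-- alternative expansion).  𝕀 is identified with this subspace of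
-- digit sequences via x ↦ (d_k(x))_k (a homeomorphism).
InI : ∀ M → Seq (suc (suc M)) → Set
InI M x = (∀ m → ∃ λ k → m ≤ k × x k ≢ fzero)
        × (∀ m → ∃ λ k → m ≤ k × x k ≢ fromℕ (suc M))

data _begins_ {N : ℕ} (x : Seq N) : List (Fin N) → Set where
  nil  : x begins []
  cons : ∀ {d w} → x 0 ≡ d → (λ k → x (suc k)) begins w → x begins (d ∷ w)

-- Open set of 𝕀 given as a union of cylinders indexed by a set of words.
_∈Open_ : ∀ {N} → Seq N → (List (Fin N) → Set) → Set
x ∈Open U = ∃ λ w → U w × x begins w

-- U is dense in 𝕀: every nonempty basic open set of 𝕀 (cylinder ∩ 𝕀) meets U.
DenseI : ∀ M → (List (Fin (suc (suc M))) → Set) → Set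
DenseI M U = ∀ w → ∃ λ x → InI M x × x begins w × x ∈Open U

ResidualI : ∀ M → (Seq (suc (suc M)) → Set) → Set₁
ResidualI M A = Σ (ℕ → List (Fin (suc (suc M))) → Set) λ U →
  (∀ k → DenseI M (U k)) × (∀ x → InI M x → (∀ k → x ∈Open U k) → A x)

-- number of 0 ≤ k < n with x k ≡ i, i.e. |{1 ≤ j ≤ n : d_j(x) = i}|
count : ∀ {N} → Seq N → Fin N → ℕ → ℕ
count x i zero = 0
count x i (suc n) with x n ≟ i
... | yes _ = suc (count x i n)
... | no  _ = count x i n

-- Π_i(x,n) (junk value 0 for n = 0, never used)
Π : ∀ {N} → Seq N → Fin N → ℕ → ℚ
Π x i zero = 0ℚ
Π x i (suc n) = (+ count x i (suc n)) / suc n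

sumFin : ∀ n → (Fin n → ℚ) → ℚ
sumFin zero f = 0ℚ
sumFin (suc n) f = f fzero + sumFin n (λ i → f (Fin.suc i))

dist₁ : ∀ {N} → (Fin N → ℚ) → (Fin N → ℚ) → ℚ
dist₁ {N} v q = sumFin N (λ i → ∣ v i - q i ∣)

unit : ∀ {N} → Fin N → Fin N → ℚ
unit i k with i ≟ k
... | yes _ = 1ℚ
... | no  _ = 0ℚ

InD : ∀ M → (Fin (suc (suc M)) → ℚ) → Set
InD M q = (∀ i → 0ℚ ℚ.≤ q i) × sumFin (suc (suc M)) q ≡ 1ℚ
        × (¬ (∀ i → q i ≡ unit fzero i)) × (¬ (∀ i → q i ≡ unit (fromℕ (suc M)) i))

iter : ∀ {A : Set} → (A → A) → ℕ → A → A
iter f zero a = a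
iter f (suc m) a = f (iter f m a)

-- Property P_{h,ψ} of the sequence (Π(x,n))_n  (ℕ = {1,2,…}).
-- j/ψ(j) ≤ 1/h is written h·j ≤ ψ(j) (ψ(j) > 0).
PropP : ∀ M (h : ℕ) .{{_ : ℕ.NonZero h}} → (ℕ → ℕ) → Seq (suc (suc M)) → Set
PropP M h ψ x = ∀ (i m : ℕ) (q : Fin (suc (suc M)) → ℚ) → 1 ≤ i → 1 ≤ m → InD M q →
  ∃ λ j → i ≤ j × h * j ≤ ψ j ×
    (∀ n → j ≤ n → n ≤ iter ψ m j → dist₁ (λ k → Π x k n) q ℚ.< (+ 1) / h)

{-# OPTIONS --safe #-}
-- Fix i, m and a rational target q. Write q = a/D with natural counts a summing
-- to D and let y repeat a block of length D containing each digit k exactly a_k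
-- times. For any word w, after n ≥ |w| digits the digit frequencies of w ++ y
-- are within N(|w|+D)/n of q in ℓ¹, hence within 1/h from some j ≥ h on, and
-- ψ(j) > j² gives h·j ≤ ψ(j). The first ψ^m(j) digits of w ++ y span a cylinder
-- on which the window condition for (i, m, q) holds, and this cylinder meets 𝕀
-- (continue with 0, N−1, 0, N−1, …). So each of the countably many conditions
-- (i, m, q) contains a dense open subset of 𝕀.
module Submission where

open import Defs
open import Data.Nat as ℕ using (ℕ; zero; suc; _+_; _*_; _∸_; _≤_; _<_; z≤n; s≤s; NonZero)
import Data.Nat.Properties as ℕₚ
open import Data.Nat.Solver using (module +-*-Solver)
open import Data.Integer as ℤ using (-[1+_])
import Data.Integer.Properties as ℤₚ
open import Data.Rational as ℚ using (ℚ; mkℚ; 0ℚ; 1ℚ; ∣_∣; _-_; -_; toℚᵘ)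
import Data.Rational.Properties as ℚₚ
open import Data.Rational.Unnormalised as ℚᵘ using (mkℚᵘ; *≤*; *<*; *≡*)
import Data.Rational.Unnormalised.Properties as ℚᵘₚ
import Data.Rational.Solver as ℚ-Solver
open import Data.Nat.DivMod using (_%_; _/_; m%n<n; m<n⇒m%n≡m; [m+n]%n≡m%n; m≡m%n+[m/n]*n)
open import Data.Fin using (Fin; fromℕ) renaming (zero to fzero; suc to fsuc)
open import Data.Fin.Properties using (_≟_)
open import Data.List as List using (List; []; _∷_; _++_; length; replicate; applyUpTo)
import Data.List.Properties as Listₚ
open import Data.Vec using (Vec; []; _∷_; lookup; sum; map)
open import Data.Vec.Properties using (lookup-map)
open import Data.Product using (∃; ∃₂; _×_; _,_; proj₁; proj₂)
open import Relation.Nullary using (yes; no; contradiction)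
open import Data.Sum using (inj₁; inj₂)
open import Relation.Binary.PropositionalEquality
open import Function using (case_of_)

-- Fractions x/(n+1)

-- Opaque so that Agda can infer x and n from frac x n in the lemmas below.
opaque
  frac : ℕ → ℕ → ℚ
  frac x n = ℤ.+ x ℚ./ suc n

opaque
  unfolding frac

  frac-def : ∀ x n → frac x n ≡ ℤ.+ x ℚ./ suc n
  frac-def x n = refl

  toℚᵘ-frac : ∀ x n → toℚᵘ (frac x n) ℚᵘ.≃ mkℚᵘ (ℤ.+ x) n
  toℚᵘ-frac x n = ℚₚ.toℚᵘ-fromℚᵘ (mkℚᵘ (ℤ.+ x) n)

frac-mono-≤ : ∀ {x y n m} → x * suc m ≤ y * suc n → frac x n ℚ.≤ frac y m
frac-mono-≤ {x} {y} {n} {m} le = ℚₚ.toℚᵘ-cancel-≤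
  (ℚᵘₚ.≤-respˡ-≃ (ℚᵘₚ.≃-sym (toℚᵘ-frac x n)) (ℚᵘₚ.≤-respʳ-≃ (ℚᵘₚ.≃-sym (toℚᵘ-frac y m))
    (*≤* (subst₂ ℤ._≤_ (ℤₚ.pos-* x (suc m)) (ℤₚ.pos-* y (suc n)) (ℤ.+≤+ le)))))

frac-mono-< : ∀ {x y n m} → x * suc m < y * suc n → frac x n ℚ.< frac y m
frac-mono-< {x} {y} {n} {m} lt = ℚₚ.toℚᵘ-cancel-<
  (ℚᵘₚ.<-respˡ-≃ (ℚᵘₚ.≃-sym (toℚᵘ-frac x n)) (ℚᵘₚ.<-respʳ-≃ (ℚᵘₚ.≃-sym (toℚᵘ-frac y m))
    (*<* (subst₂ ℤ._<_ (ℤₚ.pos-* x (suc m)) (ℤₚ.pos-* y (suc n)) (ℤ.+<+ lt)))))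

frac-cong : ∀ {x y n m} → x * suc m ≡ y * suc n → frac x n ≡ frac y m
frac-cong {x} {y} {n} {m} eq = ℚₚ.toℚᵘ-injective (ℚᵘₚ.≃-trans (toℚᵘ-frac x n)
  (ℚᵘₚ.≃-trans (*≡* (trans (sym (ℤₚ.pos-* x (suc m))) (trans (cong ℤ.+_ eq) (ℤₚ.pos-* y (suc n)))))
    (ℚᵘₚ.≃-sym (toℚᵘ-frac y m))))

frac-injectiveˡ : ∀ {x y n} → frac x n ≡ frac y n → x ≡ y
frac-injectiveˡ {x} {y} {n} eq
  with ℚᵘₚ.≃-trans (ℚᵘₚ.≃-sym (toℚᵘ-frac x n)) (ℚᵘₚ.≃-trans (ℚₚ.toℚᵘ-cong eq) (toℚᵘ-frac y n))
... | *≡* e = ℕₚ.*-cancelʳ-≡ x y (suc n)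
  (ℤₚ.+-injective (trans (ℤₚ.pos-* x (suc n)) (trans e (sym (ℤₚ.pos-* y (suc n))))))

frac-+ : ∀ x y n m → frac x n ℚ.+ frac y m ≡ frac (x * suc m + y * suc n) (m + n * suc m)
frac-+ x y n m = ℚₚ.toℚᵘ-injective
  (ℚᵘₚ.≃-trans (ℚₚ.toℚᵘ-homo-+ (frac x n) (frac y m))
  (ℚᵘₚ.≃-trans (ℚᵘₚ.+-cong (toℚᵘ-frac x n) (toℚᵘ-frac y m))
  (ℚᵘₚ.≃-trans (ℚᵘₚ.≃-reflexive (cong (λ z → mkℚᵘ z (m + n * suc m)) numerator))
    (ℚᵘₚ.≃-sym (toℚᵘ-frac _ _)))))
  where
  numerator : ℤ.+ x ℤ.* ℤ.+ suc m ℤ.+ ℤ.+ y ℤ.* ℤ.+ suc n ≡ ℤ.+ (x * suc m + y * suc n)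
  numerator = trans (cong₂ ℤ._+_ (sym (ℤₚ.pos-* x (suc m))) (sym (ℤₚ.pos-* y (suc n))))
                    (sym (ℤₚ.pos-+ (x * suc m) (y * suc n)))

frac-+-same : ∀ x y n → frac x n ℚ.+ frac y n ≡ frac (x + y) n
frac-+-same x y n = trans (frac-+ x y n n) (frac-cong (solve 3 (λ x y n →
  (x :* n :+ y :* n) :* n := (x :+ y) :* (n :* n)) refl x y (suc n)))
  where open +-*-Solver

frac-zero : ∀ n → frac 0 n ≡ 0ℚ
frac-zero n = trans (frac-cong {0} {0} {n} {0} refl) (frac-def 0 0)

p≤q+r⇒p-q≤r : ∀ {p q r} → p ℚ.≤ q ℚ.+ r → p - q ℚ.≤ r
p≤q+r⇒p-q≤r {p} {q} {r} le = ℚₚ.≤-trans (ℚₚ.+-monoˡ-≤ (- q) le)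
  (ℚₚ.≤-reflexive (solve 2 (λ q r → (q :+ r) :- q := r) refl q r))
  where open ℚ-Solver.+-*-Solver

∣p-q∣≤r : ∀ {p q r} → p ℚ.≤ q ℚ.+ r → q ℚ.≤ p ℚ.+ r → ∣ p - q ∣ ℚ.≤ r
∣p-q∣≤r {p} {q} {r} p≤q+r q≤p+r with ℚₚ.∣p∣≡p∨∣p∣≡-p (p - q)
... | inj₁ eq = subst (ℚ._≤ r) (sym eq) (p≤q+r⇒p-q≤r p≤q+r)
... | inj₂ eq = subst (ℚ._≤ r) (sym (trans eq (solve 2 (λ p q → :- (p :- q) := q :- p) refl p q)))
                      (p≤q+r⇒p-q≤r q≤p+r)
  where open ℚ-Solver.+-*-Solver

Near : ℕ → ℕ → ℕ → Set
Near B p q = p ≤ q + B × q ≤ p + B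

near-+ : ∀ {u v B} X → u ≤ B → v ≤ B → Near B (u + X) (v + X)
near-+ {u} {v} {B} X u≤B v≤B = shifted u≤B , shifted v≤B
  where
  open ℕₚ.≤-Reasoning
  shifted : ∀ {a b} → a ≤ B → a + X ≤ b + X + B
  shifted {a} {b} a≤B = begin
    a + X     ≤⟨ ℕₚ.+-monoˡ-≤ X a≤B ⟩
    B + X     ≡⟨ ℕₚ.+-comm B X ⟩
    X + B     ≤⟨ ℕₚ.+-monoˡ-≤ B (ℕₚ.m≤n+m X b) ⟩
    b + X + B ∎

∣frac-frac∣≤frac : ∀ {c a B n d} → Near (B * suc d) (c * suc d) (a * suc n) →
                   ∣ frac c n - frac a d ∣ ℚ.≤ frac B n
∣frac-frac∣≤frac {c} {a} {B} {n} {d} (c≤ , a≤) = ∣p-q∣≤r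
  (subst (frac c n ℚ.≤_) (sym (frac-+ a B d n)) (frac-mono-≤ (begin
    c * (suc d * suc n)             ≡⟨ ℕₚ.*-assoc c (suc d) (suc n) ⟨
    c * suc d * suc n               ≤⟨ ℕₚ.*-monoˡ-≤ (suc n) c≤ ⟩
    (a * suc n + B * suc d) * suc n ∎)))
  (subst (frac a d ℚ.≤_) (sym (frac-+-same c B n)) (frac-mono-≤ (begin
    a * suc n               ≤⟨ a≤ ⟩
    c * suc d + B * suc d   ≡⟨ ℕₚ.*-distribʳ-+ (suc d) c B ⟨
    (c + B) * suc d         ∎)))
  where open ℕₚ.≤-Reasoning

sumFin-cong : ∀ n {f g : Fin n → ℚ} → (∀ k → f k ≡ g k) → sumFin n f ≡ sumFin n g
sumFin-cong zero    eq = refl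
sumFin-cong (suc n) eq = cong₂ ℚ._+_ (eq fzero) (sumFin-cong n (λ k → eq (fsuc k)))

sumFin-≤-frac : ∀ n {f : Fin n → ℚ} {B m} → (∀ k → f k ℚ.≤ frac B m) → sumFin n f ℚ.≤ frac (n * B) m
sumFin-≤-frac zero    {m = m} _  = ℚₚ.≤-reflexive (sym (frac-zero m))
sumFin-≤-frac (suc n) {B = B} {m} le = ℚₚ.≤-trans
  (ℚₚ.+-mono-≤ (le fzero) (sumFin-≤-frac n (λ k → le (fsuc k))))
  (ℚₚ.≤-reflexive (frac-+-same B (n * B) m))

sumFin-frac : ∀ {n} (a : Vec ℕ n) d → sumFin n (λ k → frac (lookup a k) d) ≡ frac (sum a) d
sumFin-frac []      d = sym (frac-zero d)
sumFin-frac (x ∷ a) d = trans (cong (frac x d ℚ.+_) (sumFin-frac a d)) (frac-+-same x (sum a) d)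

dist₁-cong : ∀ {N} {v v′ q q′ : Fin N → ℚ} → (∀ k → v k ≡ v′ k) → (∀ k → q k ≡ q′ k) →
             dist₁ v q ≡ dist₁ v′ q′
dist₁-cong {N} v≡ q≡ = sumFin-cong N (λ k → cong₂ (λ a b → ∣ a - b ∣) (v≡ k) (q≡ k))

_++ₛ_ : ∀ {N} → List (Fin N) → Seq N → Seq N
([]      ++ₛ y) p       = y p
((d ∷ w) ++ₛ y) zero    = d
((d ∷ w) ++ₛ y) (suc p) = (w ++ₛ y) p

++ₛ-shift : ∀ {N} (w : List (Fin N)) y p → (w ++ₛ y) (length w + p) ≡ y p
++ₛ-shift []      y p = refl
++ₛ-shift (d ∷ w) y p = ++ₛ-shift w y p

++ₛ-begins : ∀ {N} (w : List (Fin N)) y → (w ++ₛ y) begins w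
++ₛ-begins []      y = nil
++ₛ-begins (d ∷ w) y = cons refl (++ₛ-begins w y)

++ₛ-begins-++ : ∀ {N} (w : List (Fin N)) {y v} → y begins v → (w ++ₛ y) begins (w ++ v)
++ₛ-begins-++ []      y-v = y-v
++ₛ-begins-++ (d ∷ w) y-v = cons refl (++ₛ-begins-++ w y-v)

applyUpTo-begins : ∀ {N} (x : Seq N) n → x begins applyUpTo x n
applyUpTo-begins x zero    = nil
applyUpTo-begins x (suc n) = cons refl (applyUpTo-begins (λ p → x (suc p)) n)

AgreeBelow : ∀ {N} → ℕ → Seq N → Seq N → Set
AgreeBelow n x y = ∀ p → p < n → x p ≡ y p

begins-agree : ∀ {N} {x y : Seq N} {w} → x begins w → y begins w → AgreeBelow (length w) x y
begins-agree (cons x₀ _)   (cons y₀ _)   zero    _         = trans x₀ (sym y₀)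
begins-agree (cons _ x-w) (cons _ y-w) (suc p) (s≤s p<n) = begins-agree x-w y-w p p<n

agree-≤ : ∀ {N} {x y : Seq N} {m n} → n ≤ m → AgreeBelow m x y → AgreeBelow n x y
agree-≤ n≤m x≈y p p<n = x≈y p (ℕₚ.<-≤-trans p<n n≤m)

interior : ∀ {N} → (Seq N → Set) → List (Fin N) → Set
interior P w = ∀ y → y begins w → P y

∈Open-interior : ∀ {N} {P : Seq N → Set} {x} → x ∈Open interior P → P x
∈Open-interior (w , inside , x-w) = inside _ x-w

++ₛ-InI : ∀ {M} (w : List (Fin (suc (suc M)))) {z} → InI M z → InI M (w ++ₛ z)
++ₛ-InI w {z} (not-first , not-last) = shift not-first , shift not-last
  where
  shift : ∀ {d} → (∀ m → ∃ λ k → m ≤ k × z k ≢ d) → ∀ m → ∃ λ k → m ≤ k × (w ++ₛ z) k ≢ d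
  shift {d} often m with often m
  ... | k , m≤k , zk≢d = length w + k , ℕₚ.≤-trans m≤k (ℕₚ.m≤n+m k (length w))
                       , subst (_≢ d) (sym (++ₛ-shift w z k)) zk≢d

alternating : ∀ M → Seq (suc (suc M))
alternating M zero          = fzero
alternating M (suc zero)    = fromℕ (suc M)
alternating M (suc (suc p)) = alternating M p

alternating-recurrent : ∀ M m → ∃ λ k → m ≤ k × alternating M k ≡ fzero × alternating M (suc k) ≡ fromℕ (suc M)
alternating-recurrent M zero    = 0 , z≤n , refl , refl
alternating-recurrent M (suc m) with alternating-recurrent M m
... | k , m≤k , first , last = suc (suc k) , s≤s (ℕₚ.m≤n⇒m≤1+n m≤k) , first , last

alternating-InI : ∀ M → InI M (alternating M)
alternating-InI M = not-first , not-last
  where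
  not-first : ∀ m → ∃ λ k → m ≤ k × alternating M k ≢ fzero
  not-first m with alternating-recurrent M m
  ... | k , m≤k , _ , last = suc k , ℕₚ.m≤n⇒m≤1+n m≤k , λ eq → case trans (sym last) eq of λ ()
  not-last : ∀ m → ∃ λ k → m ≤ k × alternating M k ≢ fromℕ (suc M)
  not-last m with alternating-recurrent M m
  ... | k , m≤k , first , _ = k , m≤k , λ eq → case trans (sym first) eq of λ ()

count-agree : ∀ {N} {x y : Seq N} i n → AgreeBelow n x y → count x i n ≡ count y i n
count-agree i zero    x≈y = refl
count-agree {x = x} {y} i (suc n) x≈y with x n ≟ i | y n ≟ i
... | yes _   | yes _   = cong suc (count-agree i n (agree-≤ (ℕₚ.n≤1+n n) x≈y))
... | no  _   | no  _   = count-agree i n (agree-≤ (ℕₚ.n≤1+n n) x≈y)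
... | yes x≡i | no  y≢i = contradiction (trans (sym (x≈y n ℕₚ.≤-refl)) x≡i) y≢i
... | no  x≢i | yes y≡i = contradiction (trans (x≈y n ℕₚ.≤-refl) y≡i) x≢i

count-+ : ∀ {N} (x : Seq N) i m n → count x i (m + n) ≡ count x i m + count (λ p → x (m + p)) i n
count-+ x i m zero    = trans (cong (count x i) (ℕₚ.+-identityʳ m)) (sym (ℕₚ.+-identityʳ _))
count-+ x i m (suc n) rewrite ℕₚ.+-suc m n with x (m + n) ≟ i
... | yes _ = trans (cong suc (count-+ x i m n)) (sym (ℕₚ.+-suc _ _))
... | no  _ = count-+ x i m n

count-≤ : ∀ {N} (x : Seq N) i n → count x i n ≤ n
count-≤ x i zero = z≤n
count-≤ x i (suc n) with x n ≟ i
... | yes _ = s≤s (count-≤ x i n)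
... | no  _ = ℕₚ.m≤n⇒m≤1+n (count-≤ x i n)

count-mono : ∀ {N} (x : Seq N) i {m n} → m ≤ n → count x i m ≤ count x i n
count-mono x i {m} {n} m≤n = begin
  count x i m                         ≤⟨ ℕₚ.m≤m+n _ _ ⟩
  count x i m + count _ i (n ∸ m)     ≡⟨ count-+ x i m (n ∸ m) ⟨
  count x i (m + (n ∸ m))             ≡⟨ cong (count x i) (ℕₚ.m+[n∸m]≡n m≤n) ⟩
  count x i n                         ∎
  where open ℕₚ.≤-Reasoning

Π-agree : ∀ {N} {x y : Seq N} i n → AgreeBelow n x y → Π x i n ≡ Π y i n
Π-agree i zero    x≈y = refl
Π-agree i (suc n) x≈y = cong (λ c → ℤ.+ c ℚ./ suc n) (count-agree i (suc n) x≈y)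

countL : ∀ {N} → Fin N → List (Fin N) → ℕ
countL i []      = 0
countL i (d ∷ w) with d ≟ i
... | yes _ = suc (countL i w)
... | no  _ = countL i w

count-++ₛ : ∀ {N} (w : List (Fin N)) y i → count (w ++ₛ y) i (length w) ≡ countL i w
count-++ₛ []      y i = refl
count-++ₛ (d ∷ w) y i with count-+ ((d ∷ w) ++ₛ y) i 1 (length w)
... | split with d ≟ i
...   | yes _ = trans split (cong suc (count-++ₛ w y i))
...   | no  _ = trans split (count-++ₛ w y i)

countL-++ : ∀ {N} (i : Fin N) u v → countL i (u ++ v) ≡ countL i u + countL i v
countL-++ i []      v = refl
countL-++ i (d ∷ u) v with d ≟ i
... | yes _ = cong suc (countL-++ i u v)
... | no  _ = countL-++ i u v

countL-replicate-zero : ∀ {N} c → countL {suc N} fzero (replicate c fzero) ≡ c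
countL-replicate-zero zero    = refl
countL-replicate-zero (suc c) = cong suc (countL-replicate-zero c)

countL-replicate-suc : ∀ {N} (i : Fin N) c → countL (fsuc i) (replicate c fzero) ≡ 0
countL-replicate-suc i zero    = refl
countL-replicate-suc i (suc c) = countL-replicate-suc i c

countL-map-suc-zero : ∀ {N} (w : List (Fin N)) → countL fzero (List.map fsuc w) ≡ 0
countL-map-suc-zero []      = refl
countL-map-suc-zero (d ∷ w) = countL-map-suc-zero w

countL-map-suc : ∀ {N} (i : Fin N) w → countL (fsuc i) (List.map fsuc w) ≡ countL i w
countL-map-suc i []      = refl
countL-map-suc i (d ∷ w) with d ≟ i
... | yes _ = cong suc (countL-map-suc i w)
... | no  _ = countL-map-suc i w

block : ∀ {n} → Vec ℕ n → List (Fin n)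
block []      = []
block (c ∷ a) = replicate c fzero ++ List.map fsuc (block a)

length-block : ∀ {n} (a : Vec ℕ n) → length (block a) ≡ sum a
length-block []      = refl
length-block (c ∷ a) = begin
  length (replicate c fzero ++ List.map fsuc (block a))      ≡⟨ Listₚ.length-++ (replicate c fzero) ⟩
  length (replicate c fzero) + length (List.map fsuc (block a)) ≡⟨ cong₂ _+_ (Listₚ.length-replicate c)
                                                                   (Listₚ.length-map fsuc (block a)) ⟩
  c + length (block a)                                        ≡⟨ cong (c +_) (length-block a) ⟩
  c + sum a                                                   ∎
  where open ≡-Reasoning

countL-block : ∀ {n} (a : Vec ℕ n) i → countL i (block a) ≡ lookup a i
countL-block (c ∷ a) fzero = begin
  countL fzero (replicate c fzero ++ List.map fsuc (block a))
    ≡⟨ countL-++ fzero (replicate c fzero) _ ⟩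
  countL fzero (replicate c fzero) + countL fzero (List.map fsuc (block a))
    ≡⟨ cong₂ _+_ (countL-replicate-zero c) (countL-map-suc-zero (block a)) ⟩
  c + 0
    ≡⟨ ℕₚ.+-identityʳ c ⟩
  c ∎
  where open ≡-Reasoning
countL-block (c ∷ a) (fsuc i) = begin
  countL (fsuc i) (replicate c fzero ++ List.map fsuc (block a))
    ≡⟨ countL-++ (fsuc i) (replicate c fzero) _ ⟩
  countL (fsuc i) (replicate c fzero) + countL (fsuc i) (List.map fsuc (block a))
    ≡⟨ cong₂ _+_ (countL-replicate-suc i c) (countL-map-suc i (block a)) ⟩
  countL i (block a)
    ≡⟨ countL-block a i ⟩
  lookup a i ∎
  where open ≡-Reasoning

-- Frequencies in eventually periodic sequences

Periodic : ∀ {N} → ℕ → Seq N → Set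
Periodic D y = ∀ p → y (D + p) ≡ y p

count-periodic : ∀ {N} {D} {y : Seq N} → Periodic D y → ∀ i t r →
                 count y i (t * D + r) ≡ t * count y i D + count y i r
count-periodic y-per i zero r = refl
count-periodic {D = D} {y} y-per i (suc t) r = begin
  count y i (D + t * D + r)
    ≡⟨ cong (count y i) (ℕₚ.+-assoc D (t * D) r) ⟩
  count y i (D + (t * D + r))
    ≡⟨ count-+ y i D (t * D + r) ⟩
  count y i D + count (λ p → y (D + p)) i (t * D + r)
    ≡⟨ cong (count y i D +_) (count-agree i (t * D + r) (λ p _ → y-per p)) ⟩
  count y i D + count y i (t * D + r)
    ≡⟨ cong (count y i D +_) (count-periodic y-per i t r) ⟩
  count y i D + (t * count y i D + count y i r)
    ≡⟨ ℕₚ.+-assoc (count y i D) _ _ ⟨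
  suc t * count y i D + count y i r ∎
  where open ≡-Reasoning

repeat : ∀ {N} D .{{_ : NonZero D}} → Seq N → Seq N
repeat D y p = y (p % D)

repeat-periodic : ∀ {N} D .{{_ : NonZero D}} (y : Seq N) → Periodic D (repeat D y)
repeat-periodic D y p = cong y (trans (cong (_% D) (ℕₚ.+-comm D p)) ([m+n]%n≡m%n p D))

count-repeat : ∀ {N} D .{{_ : NonZero D}} (y : Seq N) i → count (repeat D y) i D ≡ count y i D
count-repeat D y i = count-agree i D (λ p p<D → cong y (m<n⇒m%n≡m p<D))

count-repeat-block : ∀ {n} (a : Vec ℕ n) {D′} → sum a ≡ suc D′ → ∀ z i →
                     count (repeat (suc D′) (block a ++ₛ z)) i (suc D′) ≡ lookup a i
count-repeat-block a {D′} sum≡ z i = begin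
  count (repeat (suc D′) (block a ++ₛ z)) i (suc D′)  ≡⟨ count-repeat (suc D′) (block a ++ₛ z) i ⟩
  count (block a ++ₛ z) i (suc D′)                    ≡⟨ cong (count (block a ++ₛ z) i) length≡ ⟨
  count (block a ++ₛ z) i (length (block a))          ≡⟨ count-++ₛ (block a) z i ⟩
  countL i (block a)                                  ≡⟨ countL-block a i ⟩
  lookup a i                                          ∎
  where
  open ≡-Reasoning
  length≡ : length (block a) ≡ suc D′
  length≡ = trans (length-block a) sum≡

module _ {N} (w : List (Fin N)) {D′} {y : Seq N} (y-periodic : Periodic (suc D′) y) (i : Fin N) where
  private
    L = length w
    D = suc D′
    x = w ++ₛ y
    A = count y i D

  count-++ₛ-periodic : ∀ t r → count x i (L + (t * D + r)) ≡ count x i L + (t * A + count y i r)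
  count-++ₛ-periodic t r = trans (count-+ x i L (t * D + r)) (cong (count x i L +_)
    (trans (count-agree i (t * D + r) (λ p _ → ++ₛ-shift w y p)) (count-periodic y-periodic i t r)))

  -- For n = |w| + t·D + r the t full periods contribute t·A·D to both sides.
  count-++ₛ-periodic-near : ∀ {n} → L ≤ n → Near ((L + D) * D) (count x i n * D) (A * n)
  count-++ₛ-periodic-near {n} L≤n = subst (λ n → Near ((L + D) * D) (count x i n * D) (A * n)) n≡ near
    where
    open +-*-Solver
    s = n ∸ L
    t = s / D
    r = s % D
    n≡ : L + (t * D + r) ≡ n
    n≡ = trans (cong (L +_) (trans (ℕₚ.+-comm (t * D) r) (sym (m≡m%n+[m/n]*n s D)))) (ℕₚ.m+[n∸m]≡n L≤n)
    r≤D = ℕₚ.<⇒≤ (m%n<n s D)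
    A≤D = count-≤ y i D
    cL = count x i L
    cr = count y i r
    u≤ : (cL + cr) * D ≤ (L + D) * D
    u≤ = ℕₚ.*-monoˡ-≤ D (ℕₚ.+-mono-≤ (count-≤ x i L) (ℕₚ.≤-trans (count-mono y i r≤D) A≤D))
    v≤ : A * (L + r) ≤ (L + D) * D
    v≤ = ℕₚ.≤-trans (ℕₚ.*-mono-≤ A≤D (ℕₚ.+-monoʳ-≤ L r≤D)) (ℕₚ.≤-reflexive (ℕₚ.*-comm D (L + D)))
    count≡ : (cL + cr) * D + t * A * D ≡ count x i (L + (t * D + r)) * D
    count≡ = trans (solve 5 (λ cL cr t A D → (cL :+ cr) :* D :+ t :* A :* D := (cL :+ (t :* A :+ cr)) :* D)
                          refl cL cr t A D)
                   (cong (_* D) (sym (count-++ₛ-periodic t r)))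
    length≡ : A * (L + r) + t * A * D ≡ A * (L + (t * D + r))
    length≡ = solve 5 (λ A L r t D → A :* (L :+ r) :+ t :* A :* D := A :* (L :+ (t :* D :+ r))) refl A L r t D
    near : Near ((L + D) * D) (count x i (L + (t * D + r)) * D) (A * (L + (t * D + r)))
    near = subst₂ (Near ((L + D) * D)) count≡ length≡ (near-+ (t * A * D) u≤ v≤)

  Π-++ₛ-periodic-near : ∀ {n} → L ≤ suc n → ∣ Π x i (suc n) - frac A D′ ∣ ℚ.≤ frac (L + D) n
  Π-++ₛ-periodic-near {n} L≤n = subst (λ p → ∣ p - frac A D′ ∣ ℚ.≤ frac (L + D) n)
    (frac-def (count x i (suc n)) n) (∣frac-frac∣≤frac (count-++ₛ-periodic-near L≤n))

dist₁-++ₛ-periodic< : ∀ {N} (w : List (Fin N)) {D′} {y : Seq N} → Periodic (suc D′) y → ∀ {n h} →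
  length w ≤ suc n → N * (length w + suc D′) * suc h < suc n →
  dist₁ (λ i → Π (w ++ₛ y) i (suc n)) (λ i → frac (count y i (suc D′)) D′) ℚ.< frac 1 h
dist₁-++ₛ-periodic< {N} w {D′} y-periodic {n} {h} L≤n large = ℚₚ.≤-<-trans
  (sumFin-≤-frac N (λ i → Π-++ₛ-periodic-near w y-periodic i L≤n))
  (frac-mono-< (subst (N * (length w + suc D′) * suc h <_) (sym (ℕₚ.*-identityˡ (suc n))) large))

-- Enumerating parameter vectors

step : ℕ × ℕ → ℕ × ℕ
step (a , suc b) = suc a , b
step (a , zero)  = zero , suc a

unpair : ℕ → ℕ × ℕ
unpair zero    = 0 , 0
unpair (suc n) = step (unpair n)

unpair-diagonal : ∀ a b {n} → unpair n ≡ (0 , a + b) → unpair (a + n) ≡ (a , b)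
unpair-diagonal zero    b eq = eq
unpair-diagonal (suc a) b eq =
  cong step (unpair-diagonal a (suc b) (trans eq (cong (0 ,_) (sym (ℕₚ.+-suc a b)))))

unpair-diagonal-start : ∀ s → ∃ λ n → unpair n ≡ (0 , s)
unpair-diagonal-start zero    = 0 , refl
unpair-diagonal-start (suc s) with unpair-diagonal-start s
... | n , eq = suc (s + n) , cong step (unpair-diagonal s 0 (trans eq (cong (0 ,_) (sym (ℕₚ.+-identityʳ s)))))

unpair-surjective : ∀ a b → ∃ λ n → unpair n ≡ (a , b)
unpair-surjective a b with unpair-diagonal-start (a + b)
... | n , eq = a + n , unpair-diagonal a b eq

decode : ∀ k → ℕ → Vec ℕ k
decode zero    c = []
decode (suc k) c = proj₁ (unpair c) ∷ decode k (proj₂ (unpair c))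

decode-surjective : ∀ {k} (v : Vec ℕ k) → ∃ λ c → decode k c ≡ v
decode-surjective []      = 0 , refl
decode-surjective (a ∷ v) with decode-surjective v
... | c′ , eq′ with unpair-surjective a c′
... | c , eq = c , cong₂ _∷_ (cong proj₁ eq) (trans (cong (λ p → decode _ (proj₂ p)) eq) eq′)

-- Rational probability vectors as digit counts

nonNegative⇒frac : ∀ p → 0ℚ ℚ.≤ p → ∃₂ λ x d → p ≡ frac x d
nonNegative⇒frac p@(mkℚ (ℤ.+ x) d _) _ = x , d , trans (sym (ℚₚ.↥p/↧p≡p p)) (sym (frac-def x d))
nonNegative⇒frac (mkℚ -[1+ _ ] _ _) (ℚ.*≤* ())

common-denominator : ∀ {n} (q : Fin n → ℚ) → (∀ k → 0ℚ ℚ.≤ q k) →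
                     ∃₂ λ D (a : Vec ℕ n) → ∀ k → q k ≡ frac (lookup a k) D
common-denominator {zero}  q q≥0 = 0 , [] , λ ()
common-denominator {suc n} q q≥0
  with nonNegative⇒frac (q fzero) (q≥0 fzero) | common-denominator (λ k → q (fsuc k)) (λ k → q≥0 (fsuc k))
... | x , d , q₀≡ | D , a , q≡ = D + d * suc D , x * suc D ∷ map (_* suc d) a , rescaled
  where
  open +-*-Solver
  rescaled : ∀ k → q k ≡ frac (lookup (x * suc D ∷ map (_* suc d) a) k) (D + d * suc D)
  rescaled fzero    = trans q₀≡ (frac-cong (solve 3 (λ x d D → x :* (d :* D) := x :* D :* d)
                                                     refl x (suc d) (suc D)))
  rescaled (fsuc k) = trans (q≡ k) (trans (frac-cong (solve 3 (λ y d D → y :* (d :* D) := y :* d :* D)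
                                                               refl (lookup a k) (suc d) (suc D)))
                                          (cong (λ y → frac y _) (sym (lookup-map k (_* suc d) a))))

InD⇒counts : ∀ {M q} → InD M q →
             ∃₂ λ D (a : Vec ℕ (suc (suc M))) → (∀ k → q k ≡ frac (lookup a k) D) × sum a ≡ suc D
InD⇒counts {M} {q} (q≥0 , sum≡1 , _) with common-denominator q q≥0
... | D , a , q≡ = D , a , q≡ , frac-injectiveˡ (begin
  frac (sum a) D                                      ≡⟨ sumFin-frac a D ⟨
  sumFin (suc (suc M)) (λ k → frac (lookup a k) D)    ≡⟨ sumFin-cong (suc (suc M)) (λ k → sym (q≡ k)) ⟩
  sumFin (suc (suc M)) q                              ≡⟨ sum≡1 ⟩
  1ℚ                                                  ≡⟨ frac-def 1 0 ⟨
  frac 1 0                                            ≡⟨ frac-cong (ℕₚ.*-comm 1 (suc D)) ⟩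
  frac (suc D) D                                      ∎)
  where open ≡-Reasoning

-- The dense open sets

module DenseOpenSets (M h : ℕ) (ψ : ℕ → ℕ) (ψ-superquadratic : ∀ n → 1 ≤ n → n * n < ψ n) where

  N = suc (suc M)

  -- Definitionally the conclusion of PropP M (suc h) ψ x for one triple (i, m, q).
  Window : ℕ → ℕ → (Fin N → ℚ) → Seq N → Set
  Window i m q x = ∃ λ j → i ≤ j × suc h * j ≤ ψ j ×
    (∀ n → j ≤ n → n ≤ iter ψ m j → dist₁ (λ k → Π x k n) q ℚ.< ℤ.+ 1 ℚ./ suc h)

  Window-cong : ∀ {i m q q′ x} → (∀ k → q k ≡ q′ k) → Window i m q x → Window i m q′ x
  Window-cong {x = x} q≡ (j , i≤j , hj≤ψj , close) = j , i≤j , hj≤ψj , λ n j≤n n≤T →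
    subst (ℚ._< _) (dist₁-cong {v = λ k → Π x k n} (λ _ → refl) q≡) (close n j≤n n≤T)

  -- i ∷ m ∷ D′ ∷ a stands for the triple (i, m, a/(D′+1)); it imposes nothing unless sum a ≡ D′+1.
  Requirement : Vec ℕ (3 + N) → Seq N → Set
  Requirement (i ∷ m ∷ D′ ∷ a) x = sum a ≡ suc D′ → Window i m (λ k → frac (lookup a k) D′) x

  h*j≤ψj : ∀ {j} → suc h ≤ j → suc h * j ≤ ψ j
  h*j≤ψj {j} h<j = ℕₚ.≤-trans (ℕₚ.*-monoˡ-≤ j h<j) (ℕₚ.<⇒≤ (ψ-superquadratic j (ℕₚ.≤-trans (s≤s z≤n) h<j)))

  cylinder-window : ∀ i m (w : List (Fin N)) {D′} {y : Seq N} → Periodic (suc D′) y →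
    ∀ j → i ≤ j → suc h ≤ j → length w ≤ j → N * (length w + suc D′) * suc h < j →
    interior (Window i m (λ k → frac (count y k (suc D′)) D′)) (w ++ applyUpTo y (iter ψ m j))
  cylinder-window i m w {D′} {y} y-periodic j i≤j h<j L≤j large x x-W = j , i≤j , h*j≤ψj h<j , close
    where
    L = length w
    T = iter ψ m j
    length-W : length (w ++ applyUpTo y T) ≡ L + T
    length-W = trans (Listₚ.length-++ w) (cong (L +_) (Listₚ.length-applyUpTo y T))
    x≈wy : AgreeBelow (L + T) x (w ++ₛ y)
    x≈wy = subst (λ l → AgreeBelow l x (w ++ₛ y)) length-W
                 (begins-agree x-W (++ₛ-begins-++ w (applyUpTo-begins y T)))
    close : ∀ n → j ≤ n → n ≤ T →
            dist₁ (λ k → Π x k n) (λ k → frac (count y k (suc D′)) D′) ℚ.< ℤ.+ 1 ℚ./ suc h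
    close zero    j≤0 _   = contradiction (ℕₚ.≤-trans h<j j≤0) λ ()
    close (suc n) j≤n n≤T = subst₂ ℚ._<_
      (dist₁-cong {q = λ k → frac (count y k (suc D′)) D′}
                  (λ k → sym (Π-agree k (suc n) (agree-≤ (ℕₚ.≤-trans n≤T (ℕₚ.m≤n+m T L)) x≈wy)))
                  (λ _ → refl))
      (frac-def 1 h)
      (dist₁-++ₛ-periodic< w y-periodic (ℕₚ.≤-trans L≤j j≤n) (ℕₚ.<-≤-trans large j≤n))

  window-dense : ∀ i m D′ (a : Vec ℕ N) → sum a ≡ suc D′ → ∀ w →
    ∃ λ x → InI M x × x begins w × x ∈Open interior (Window i m (λ k → frac (lookup a k) D′))
  window-dense i m D′ a sum≡ w = x , x∈𝕀 , ++ₛ-begins w _ , w ++ applyUpTo y T , inside , x-W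
    where
    y = repeat (suc D′) (block a ++ₛ alternating M)
    L = length w
    K = N * (L + suc D′) * suc h
    j = suc (K + (L + (i + h)))
    T = iter ψ m j
    x = w ++ₛ (applyUpTo y T ++ₛ alternating M)

    x∈𝕀 : InI M x
    x∈𝕀 = ++ₛ-InI w (++ₛ-InI (applyUpTo y T) (alternating-InI M))

    x-W : x begins (w ++ applyUpTo y T)
    x-W = ++ₛ-begins-++ w (++ₛ-begins (applyUpTo y T) (alternating M))

    i≤j : i ≤ j
    i≤j = ℕₚ.m≤n⇒m≤1+n (ℕₚ.≤-trans (ℕₚ.m≤m+n i h) (ℕₚ.≤-trans (ℕₚ.m≤n+m _ L) (ℕₚ.m≤n+m _ K)))
    h<j : suc h ≤ j
    h<j = s≤s (ℕₚ.≤-trans (ℕₚ.m≤n+m h i) (ℕₚ.≤-trans (ℕₚ.m≤n+m _ L) (ℕₚ.m≤n+m _ K)))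
    L≤j : L ≤ j
    L≤j = ℕₚ.m≤n⇒m≤1+n (ℕₚ.≤-trans (ℕₚ.m≤m+n L (i + h)) (ℕₚ.m≤n+m _ K))
    K<j : K < j
    K<j = s≤s (ℕₚ.m≤m+n K _)

    inside : interior (Window i m (λ k → frac (lookup a k) D′)) (w ++ applyUpTo y T)
    inside x′ x′-W = Window-cong {i} {m} (λ k → cong (λ c → frac c D′) (count-repeat-block a sum≡ (alternating M) k))
      (cylinder-window i m w (repeat-periodic (suc D′) (block a ++ₛ alternating M)) j i≤j h<j L≤j K<j x′ x′-W)

  requirement-dense : ∀ v → DenseI M (interior (Requirement v))
  requirement-dense (i ∷ m ∷ D′ ∷ a) w with sum a ℕ.≟ suc D′
  ... | yes sum≡ = let x , x∈𝕀 , x-w , W , inside , x-W = window-dense i m D′ a sum≡ w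
                   in  x , x∈𝕀 , x-w , W , (λ x′ x′-W _ → inside x′ x′-W) , x-W
  ... | no  sum≢ = w ++ₛ alternating M , ++ₛ-InI w (alternating-InI M) , ++ₛ-begins w _
                 , w , (λ _ _ sum≡ → contradiction sum≡ sum≢) , ++ₛ-begins w _

  requirements⇒PropP : ∀ x → (∀ c → Requirement (decode (3 + N) c) x) → PropP M (suc h) ψ x
  requirements⇒PropP x requirement i m q _ _ q∈𝔻 =
    let D , a , q≡ , sum≡ = InD⇒counts q∈𝔻
        c , decode≡       = decode-surjective (i ∷ m ∷ D ∷ a)
    in  Window-cong {i} {m} (λ k → sym (q≡ k)) (subst (λ v → Requirement v x) decode≡ (requirement c) sum≡)

lemma2p2 : (M : ℕ) (h : ℕ) .{{_ : NonZero h}} (ψ : ℕ → ℕ) →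
    (∀ m n → 1 ≤ m → m < n → ψ m < ψ n) →
    (∀ n → 1 ≤ n → n * n < ψ n) →
    ResidualI M (λ x → InI M x × PropP M h ψ x)
lemma2p2 M zero {{()}}
lemma2p2 M (suc h) ψ _ ψ-superquadratic =
  (λ c → interior (Requirement (decode (3 + N) c))) , (λ c → requirement-dense (decode (3 + N) c)) ,
  λ x x∈𝕀 x∈U → x∈𝕀 , requirements⇒PropP x (λ c → ∈Open-interior (x∈U c))
  where open DenseOpenSets M h ψ ψ-superquadratic
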